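{- Let $G$ be a $2$-edge connected graph of diameter $d$, let $pq$ be any edge of $G$, let $k$ be the length of a shortest cycle of $G$ containing $pq$, and let $\vec{H}$ be the oriented subgraph of $G$ returned by the algorithm OrientedCore (described in the context) on input $G$, $pq$. For each $i\in\{1,0,-1\}$, let $d_i$ denote the maximum distance in $G$ from a level-$i$ vertex not in $V(\vec{H})$ to the set of level-$i$ vertices in $V(\vec{H})$. Then $d_0\le d-\lfloor k/2\rfloor$, $d_1, d_{ -1}\le d-\lceil k/4\rceil$, and for any distinct $i,j\in\{1,0,-1\}$, $d_i+d_j\le d-1$.
   Context: Setting: $G$ is a $2$-edge connected graph of diameter $d$, $pq$ an edge, $k$ the length of a shortest cycle containing $pq$. For integers $i,j$ let $S_{i,j}=\{v\in V(G): d_G(v,p)=i,\ d_G(v,q)=j\}$. For $v\in S_{i,j}$ its level is $L(v)=j-i\in\{1,0,-1\}$ and its width is $W(v)=\max(i,j)$. An edge between vertices lying in different sets $S_{i,j}$ is written $uv$ when either $L(u)>L(v)$ (then it is called vertical) or $L(u)=L(v)$ and $W(u)<W(v)$ (horizontal). Algorithm OrientedCore builds an oriented subgraph $\vec{H}$ (shortest paths below are in $G$): Stage 1: start with $\vec{H}$ empty. For each vertical edge $uv$ with $L(u)=1$, $L(v)\in\{0,-1\}$, and for each shortest $p$–$u$ path $P_u$ and each shortest $v$–$q$ path $P_v$, orient the $p$–$q$ path formed by $P_u$, $uv$, $P_v$ as a directed path from $p$ to $q$ and add it to $\vec{H}$. Stage 2: for each vertical edge $uv$ with $L(u)=0$,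 $L(v)=-1$ not already oriented in Stage 1, and for each shortest $p$–$u$ path $P_u$ and shortest $v$–$q$ path $P_v$: let $x$ be the last vertex of $P_u$ (nearest to $u$) already in $V(\vec{H})$ and $P_u'$ the subpath from $x$ to $u$; let $y$ be the first vertex of $P_v$ (nearest to $v$) already in $V(\vec{H})$ and $P_v'$ the subpath from $v$ to $y$; orient the $x$–$y$ path formed by $P_u'$, $uv$, $P_v'$ from $x$ to $y$ and add it to $\vec{H}$. (These orientations never conflict.) Stage 3: orient $pq$ from $q$ to $p$ and add it to $\vec{H}$. The output is $\vec{H}$. Vertices of $V(\vec{H})$ are called captured, the others uncaptured; $d_i$ is the maximum over uncaptured level-$i$ vertices $u$ of $\min\{d_G(u,w): w \text{ captured of level } i\}$ (taken to be $0$ if there are no uncaptured level-$i$ vertices). -}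

module Defs where

open import Data.Nat using (ℕ; zero; suc; _+_; _≤_; _/_)
open import Data.Fin using (Fin; _≟_)
open import Data.Bool using (Bool; true; false; _∧_; _∨_; if_then_else_)
open import Data.List using (List; []; _∷_; _++_; length; allFin)
open import Data.Bool.ListAction using (any)
open import Data.List.Membership.Propositional using (_∈_)
open import Data.List.Relation.Unary.All using (All)
open import Data.Integer using (ℤ; +_; -[1+_]; _-_)
open import Data.Product using (Σ; ∃; _×_; _,_)
open import Data.Sum using (_⊎_)
open import Relation.Nullary using (¬_; Dec)
open import Relation.Nullary.Decidable using (⌊_⌋)
open import Relation.Binary.PropositionalEquality using (_≡_)

record Graph (n : ℕ) : Set₁ where
  field
    Adj    : Fin n → Fin n → Set
    adj?   : ∀ u v → Dec (Adj u v)
    sym    : ∀ {u v} → Adj u v → Adj v u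
    irrefl : ∀ {u} → ¬ Adj u u

module GraphDefs {n : ℕ} (G : Graph n) where
  open Graph G

  V : Set
  V = Fin n

  -- Walks w.r.t. an arbitrary adjacency relation R, given as the list of
  -- their vertices (a walk with m edges has m+1 vertices).
  data WalkR (R : V → V → Set) : V → V → List V → Set where
    single : ∀ v → WalkR R v v (v ∷ [])
    step   : ∀ {u w b xs} → R u w → WalkR R w b xs → WalkR R u b (u ∷ xs)

  Walk : V → V → List V → Set
  Walk = WalkR Adj

  AdjWithout : V → V → V → V → Set
  AdjWithout a b x y = Adj x y × ¬ (x ≡ a × y ≡ b) × ¬ (x ≡ b × y ≡ a)

  Connected : Set
  Connected = ∀ u v → ∃ λ xs → Walk u v xs

  TwoEdgeConnected : Set
  TwoEdgeConnected =
    Connected × (∀ a b → Adj a b → ∀ u v → ∃ λ xs → WalkR (AdjWithout a b) u v xs)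

  reach : ℕ → V → V → Bool
  reach zero    u v = ⌊ u ≟ v ⌋
  reach (suc k) u v = reach k u v ∨ any (λ w → reach k u w ∧ ⌊ adj? w v ⌋) (allFin n)

  -- graph distance: least k with reach k u v (for connected G this is < n)
  searchDist : V → V → ℕ → ℕ → ℕ
  searchDist u v zero    k = k
  searchDist u v (suc f) k = if reach k u v then k else searchDist u v f (suc k)

  dist : V → V → ℕ
  dist u v = searchDist u v n 0

  IsDiameter : ℕ → Set
  IsDiameter d = (∀ u v → dist u v ≤ d) × (∃ λ u → ∃ λ v → dist u v ≡ d)

  ShortestPath : V → V → List V → Set
  ShortestPath a b xs = Walk a b xs × length xs ≡ suc (dist a b)

  -- a cycle containing the edge pq of length m: the edge pq together with a
  -- q–p path (no repeated vertices) in G − pq with m − 1 edges, i.e. m vertices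
  data Distinct : List V → Set where
    []  : Distinct []
    _∷_ : ∀ {x xs} → ¬ (x ∈ xs) → Distinct xs → Distinct (x ∷ xs)

  CycleThrough : V → V → ℕ → Set
  CycleThrough p q m =
    ∃ λ xs → WalkR (AdjWithout p q) q p xs × Distinct xs × length xs ≡ m

  ShortestCycleLength : V → V → ℕ → Set
  ShortestCycleLength p q k =
    CycleThrough p q k × (∀ m → CycleThrough p q m → k ≤ m)

  data Consec (a b : V) : List V → Set where
    here  : ∀ {xs} → Consec a b (a ∷ b ∷ xs)
    there : ∀ {x xs} → Consec a b xs → Consec a b (x ∷ xs)

  module WithEdge (p q : V) where

    level : V → ℤ
    level v = + dist v q - + dist v p

    one zero' minusOne : ℤ
    one = + 1
    zero' = + 0
    minusOne = -[1+ 0 ]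

    -- Stage 1 data: vertical edge uv with L(u)=1, L(v)∈{0,−1}, shortest p–u
    -- path Pu and shortest v–q path Pv; the oriented p–q path is Pu ++ Pv.
    Stage1 : V → V → List V → List V → Set
    Stage1 u v Pu Pv =
      Adj u v × level u ≡ one × (level v ≡ zero' ⊎ level v ≡ minusOne) ×
      ShortestPath p u Pu × ShortestPath v q Pv

    Captured1 : V → Set
    Captured1 z = ∃ λ u → ∃ λ v → ∃ λ Pu → ∃ λ Pv →
      Stage1 u v Pu Pv × z ∈ (Pu ++ Pv)

    OrientedInStage1 : V → V → Set
    OrientedInStage1 a b = ∃ λ u → ∃ λ v → ∃ λ Pu → ∃ λ Pv →
      Stage1 u v Pu Pv × (Consec a b (Pu ++ Pv) ⊎ Consec b a (Pu ++ Pv))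

    Item : Set
    Item = V × V × List V × List V

    Stage2Item : Item → Set
    Stage2Item (u , v , Pu , Pv) =
      Adj u v × level u ≡ zero' × level v ≡ minusOne ×
      ¬ OrientedInStage1 u v ×
      ShortestPath p u Pu × ShortestPath v q Pv

    -- One run of Stage 2 processing the items in the given order, tracking
    -- the current set of captured vertices.  For an item (u,v,Pu,Pv):
    -- Pu = pre ++ x ∷ post with x the last vertex of Pu already captured,
    -- Pv = pre' ++ y ∷ post' with y the first vertex of Pv already captured;
    -- the new path x … u v … y adds the vertices of post and pre'.
    data Run : (V → Set) → List Item → (V → Set) → Set₁ where
      done : ∀ {C} → Run C [] C
      step : ∀ {C C' u v Pu Pv its} pre x post pre' y post' →
             Pu ≡ pre ++ x ∷ post → C x → All (λ z → ¬ C z) post →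
             Pv ≡ pre' ++ y ∷ post' → C y → All (λ z → ¬ C z) pre' →
             Run (λ z → C z ⊎ z ∈ post ⊎ z ∈ pre') its C' →
             Run C ((u , v , Pu , Pv) ∷ its) C'

    Enumerates : List Item → Set
    Enumerates its = (∀ t → t ∈ its → Stage2Item t) × (∀ t → Stage2Item t → t ∈ its)

    -- captured vertices V(H) after Stage 3, given the set C after Stage 2
    Final : (V → Set) → V → Set
    Final C z = C z ⊎ z ≡ p ⊎ z ≡ q

    -- D is d_i for captured set Cap: the maximum over uncaptured level-i
    -- vertices u of min {dist u w : w captured of level i}, or 0 if there
    -- are no uncaptured level-i vertices.
    IsDi : (V → Set) → ℤ → ℕ → Set
    IsDi Cap i D =
      (∀ u → level u ≡ i → ¬ Cap u →
         ∃ λ w → Cap w × level w ≡ i × dist u w ≤ D) ×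
      (D ≡ 0 ⊎ (∃ λ u → level u ≡ i × ¬ Cap u ×
         (∀ w → Cap w → level w ≡ i → D ≤ dist u w)))

module Submission where

-- The levels are 1, 0, −1 since |d(v,p) − d(v,q)| ≤ 1, and every edge joining two levels has
-- both ends captured: by Stage 1 if one end is on level 1, by Stage 2 otherwise.  Hence a
-- shortest path from an uncaptured level-i vertex x realising dᵢ to a vertex y off level i
-- leaves level i through a captured vertex s, so dᵢ + d(t,y) + 1 ≤ d(x,y) ≤ d for the next
-- vertex t.  Lower bounds on d(t,y) come from the shortest cycle through pq: a level-0
-- vertex, or an end of a level-1/level-(−1) edge other than pq, lies on a closed walk through
-- pq made of shortest paths to p and q, so it is roughly k/2 away from p and q.  For d₀ take
-- y = p; for d₁ take y at distance ⌈k/4⌉ − 1 from q where the cycle leaves level 1 (d₋₁ is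
-- symmetric); for dᵢ + dⱼ take y realising dⱼ, which is at least dⱼ away from the captured t.

open import Defs
open import Data.Nat using (ℕ; zero; suc; pred; _+_; _*_; _∸_; _≤_; _≤?_; z≤n; s≤s)
open import Data.Nat.Properties hiding (_≟_)
open import Data.Nat.DivMod using (_/_; _%_; m/n*n≤m; m%n<n; m≡m%n+[m/n]*n; m≥n⇒m/n>0)
open import Data.Nat.Tactic.RingSolver using (solve-∀)
open import Data.Integer using (ℤ; +_; -[1+_]; _-_; _⊖_)
import Data.Integer as ℤ
open import Data.Integer.Properties using (m-n≡m⊖n; n⊖n≡0; [1+m]⊖[1+n]≡m⊖n; ⊖-swap)
open import Data.Fin using (_≟_)
open import Data.Fin.Properties using (all?; any?; ¬∀⟶∃¬)
open import Data.Bool using (T; true; false; _∧_)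
open import Data.Bool.Properties using (T-∧; T-∨)
open import Data.List using (List; []; _∷_; _++_; _∷ʳ_; length; reverse; allFin)
open import Data.List.Properties using (length-++; length-reverse; unfold-reverse; length-tabulate; length-removeAt′)
open import Data.List.Relation.Unary.Any as Any using (here; there; satisfied; index; _─_)
open import Data.List.Relation.Unary.Any.Properties using (any⁺; any⁻)
open import Data.List.Membership.Propositional using (_∈_)
open import Data.List.Membership.Propositional.Properties using (∈-allFin; ∈-++⁺ˡ; ∈-++⁺ʳ; ∈-++⁻)
open import Data.List.Relation.Binary.Subset.Propositional using (_⊆_)
open import Data.Product using (∃; ∃₂; _×_; _,_; proj₁; proj₂)
open import Data.Sum using (_⊎_; inj₁; inj₂)
open import Data.Empty using (⊥-elim)
open import Function using (_∘_; id)
open import Function.Bundles using (Equivalence)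
open import Relation.Nullary using (¬_; Dec; yes; no; contradiction)
open import Relation.Nullary.Decidable
  using (⌊_⌋; toWitness; fromWitness; map′; decidable-stable; _×-dec_; _⊎-dec_; _→-dec_; ¬?)
open import Relation.Unary using (Decidable)
open import Relation.Binary.PropositionalEquality
open import Relation.Binary.Definitions using (tri<; tri≈; tri>)

m*2≡m+m : ∀ m → m * 2 ≡ m + m
m*2≡m+m m = trans (*-comm m 2) (cong (_+_ m) (+-identityʳ m))

m+m≤1+n+n⇒m≤n : ∀ {m n} → m + m ≤ suc (n + n) → m ≤ n
m+m≤1+n+n⇒m≤n {zero}          _        = z≤n
m+m≤1+n+n⇒m≤n {suc m} {zero}  (s≤s le) = contradiction (subst (_≤ 0) (+-suc m m) le) λ ()
m+m≤1+n+n⇒m≤n {suc m} {suc n} (s≤s le) =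
  s≤s (m+m≤1+n+n⇒m≤n (≤-pred (subst₂ _≤_ (+-suc m m) (cong suc (+-suc n n)) le)))

half+half≤ : ∀ k → k / 2 + k / 2 ≤ k
half+half≤ k = subst (_≤ k) (m*2≡m+m (k / 2)) (m/n*n≤m k 2)

≤1+half+half : ∀ k → k ≤ suc (k / 2 + k / 2)
≤1+half+half k = begin
  k                    ≡⟨ m≡m%n+[m/n]*n k 2 ⟩
  k % 2 + k / 2 * 2    ≤⟨ +-mono-≤ (≤-pred (m%n<n k 2)) (≤-reflexive (m*2≡m+m (k / 2))) ⟩
  suc (k / 2 + k / 2)  ∎
  where open ≤-Reasoning

half-≤ : ∀ {k x} → k ≤ suc (x + x) → k / 2 ≤ x
half-≤ {k} le = m+m≤1+n+n⇒m≤n (≤-trans (half+half≤ k) le)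

-- (k + 3) / 4 ∸ 1 is ⌈k/4⌉ − 1.
quarter∸1-double-≤ : ∀ {k x} → k ≤ 2 + (x + x) → (k + 3) / 4 ∸ 1 + ((k + 3) / 4 ∸ 1) ≤ x
quarter∸1-double-≤ {k} {x} le with (k + 3) / 4 | m/n*n≤m (k + 3) 4
... | zero  | _        = z≤n
... | suc s | 4+4s≤k+3 = m+m≤1+n+n⇒m≤n (+-cancelʳ-≤ 4 _ _ (begin
  s + s + (s + s) + 4  ≡⟨ lhs s ⟩
  suc s * 4            ≤⟨ 4+4s≤k+3 ⟩
  k + 3                ≤⟨ +-monoˡ-≤ 3 le ⟩
  2 + (x + x) + 3      ≡⟨ rhs x ⟩
  suc (x + x) + 4      ∎))
  where
  open ≤-Reasoning
  lhs : ∀ s → s + s + (s + s) + 4 ≡ suc s * 4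
  lhs = solve-∀
  rhs : ∀ x → 2 + (x + x) + 3 ≡ suc (x + x) + 4
  rhs = solve-∀

quarter≤half : ∀ {k} → 2 ≤ k → (k + 3) / 4 ≤ k / 2
quarter≤half {k} 2≤k =
  ≤-trans (m≤n+m∸n ((k + 3) / 4) 1) (suc-≤ (quarter∸1-double-≤ (m≤n⇒m≤1+n (≤1+half+half k))))
  where
  suc-≤ : ∀ {s} → s + s ≤ k / 2 → suc s ≤ k / 2
  suc-≤ {zero}  _  = m≥n⇒m/n>0 2≤k
  suc-≤ {suc s} le = ≤-trans (s≤s (m≤m+n (suc s) s)) (subst (_≤ k / 2) (+-suc (suc s) s) le)

search-down : {P : ℕ → Set} → Decidable P → ∀ m → P m →
  ∃ λ D → P D × (D ≡ 0 ⊎ ∃ λ D′ → D ≡ suc D′ × ¬ P D′)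
search-down P? zero    Pm = 0 , Pm , inj₁ refl
search-down P? (suc m) Pm with P? m
... | yes Pm′ = search-down P? m Pm′
... | no ¬Pm′ = suc m , Pm , inj₂ (m , refl , ¬Pm′)

[1+m]⊖m≡1 : ∀ m → suc m ⊖ m ≡ + 1
[1+m]⊖m≡1 zero    = refl
[1+m]⊖m≡1 (suc m) = trans ([1+m]⊖[1+n]≡m⊖n (suc m) m) ([1+m]⊖m≡1 m)

+[1+m]-+m≡1 : ∀ m → + suc m - + m ≡ + 1
+[1+m]-+m≡1 m = trans (m-n≡m⊖n (suc m) m) ([1+m]⊖m≡1 m)

+m-+m≡0 : ∀ m → + m - + m ≡ + 0
+m-+m≡0 m = trans (m-n≡m⊖n m m) (n⊖n≡0 m)

+m-+[1+m]≡-1 : ∀ m → + m - + suc m ≡ -[1+ 0 ]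
+m-+[1+m]≡-1 m = trans (m-n≡m⊖n m (suc m)) (trans (⊖-swap m (suc m)) (cong ℤ.-_ ([1+m]⊖m≡1 m)))

module _ {n : ℕ} (G : Graph n) where
  open Graph G renaming (sym to adj-sym)
  open GraphDefs G
  open import Data.List.Membership.DecPropositional (_≟_ {n}) using (_∈?_)

  private variable
    R S : V → V → Set
    a b c s t u v w x y z : V
    k l m : ℕ
    xs ys : List V

  -- A record rather than T (reach k u v), so that u and v can be inferred.
  record Reach (k : ℕ) (u v : V) : Set where
    constructor mkReach
    field holds : T (reach k u v)

  reach-weaken : Reach k u v → Reach (suc k) u v
  reach-weaken (mkReach r) = mkReach (Equivalence.from T-∨ (inj₁ r))

  reach-refl : ∀ k u → Reach k u u
  reach-refl zero    u = mkReach (fromWitness {a? = u ≟ u} refl)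
  reach-refl (suc k) u = reach-weaken (reach-refl k u)

  reach-zero : Reach 0 u v → u ≡ v
  reach-zero {u} {v} (mkReach r) = toWitness {a? = u ≟ v} r

  reach-snoc : Reach k u w → Adj w v → Reach (suc k) u v
  reach-snoc {k} {u} {w} {v} (mkReach r) wv =
    mkReach (Equivalence.from T-∨ (inj₂ (any⁺ _ (Any.map via-w (∈-allFin w)))))
    where
    via-w : ∀ {y} → w ≡ y → T (reach k u y ∧ ⌊ adj? y v ⌋)
    via-w refl = Equivalence.from T-∧ (r , fromWitness wv)

  reach-unsnoc : Reach (suc k) u v → Reach k u v ⊎ ∃ λ w → Reach k u w × Adj w v
  reach-unsnoc (mkReach r) with Equivalence.to T-∨ r
  ... | inj₁ r′ = inj₁ (mkReach r′)
  ... | inj₂ r′ with satisfied (any⁻ _ (allFin n) r′)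
  ...   | w , rw with Equivalence.to T-∧ rw
  ...     | r″ , wv = inj₂ (w , mkReach r″ , toWitness wv)

  reach-mono : k ≤ l → Reach k u v → Reach l u v
  reach-mono {zero}  {zero}  z≤n r = r
  reach-mono {zero}  {suc l} z≤n r = reach-weaken (reach-mono z≤n r)
  reach-mono {suc k} {suc l} (s≤s k≤l) r with reach-unsnoc r
  ... | inj₁ r′          = reach-weaken (reach-mono k≤l r′)
  ... | inj₂ (_ , r′ , a) = reach-snoc (reach-mono k≤l r′) a

  reach-trans : ∀ k l → Reach k u w → Reach l w v → Reach (k + l) u v
  reach-trans k zero r r′ rewrite reach-zero r′ | +-identityʳ k = r
  reach-trans k (suc l) r r′ rewrite +-suc k l with reach-unsnoc r′
  ... | inj₁ r″          = reach-weaken (reach-trans k l r r″)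
  ... | inj₂ (_ , r″ , a) = reach-snoc (reach-trans k l r r″) a

  reach-cons : Adj u w → Reach k w v → Reach (suc k) u v
  reach-cons {k = k} uw r = reach-trans 1 k (reach-snoc (reach-refl 0 _) uw) r

  reach-sym : ∀ k → Reach k u v → Reach k v u
  reach-sym zero r rewrite reach-zero r = reach-refl 0 _
  reach-sym (suc k) r with reach-unsnoc r
  ... | inj₁ r′          = reach-weaken (reach-sym k r′)
  ... | inj₂ (_ , r′ , a) = reach-cons (adj-sym a) (reach-sym k r′)

  reach-split : ∀ k l → Reach (k + l) u v → ∃ λ z → Reach k u z × Reach l z v
  reach-split {v = v} k zero r rewrite +-identityʳ k = v , r , reach-refl 0 v
  reach-split k (suc l) r rewrite +-suc k l with reach-unsnoc r
  ... | inj₁ r′ = let z , r₁ , r₂ = reach-split k l r′ in z , r₁ , reach-weaken r₂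
  ... | inj₂ (_ , r′ , a) = let z , r₁ , r₂ = reach-split k l r′ in z , r₁ , reach-snoc r₂ a

  searchDist-≤ : ∀ f j → j ≤ k → Reach k u v → searchDist u v f j ≤ k
  searchDist-≤ zero j j≤k r = j≤k
  searchDist-≤ {u = u} {v} (suc f) j j≤k r with reach j u v in e
  ... | true  = j≤k
  ... | false with m≤n⇒m<n∨m≡n j≤k
  ...   | inj₁ j<k  = searchDist-≤ f (suc j) j<k r
  ...   | inj₂ refl = contradiction (subst T e (Reach.holds r)) λ ()

  searchDist-reach : ∀ f j → m ≤ j + f → Reach m u v → Reach (searchDist u v f j) u v
  searchDist-reach {m = m} zero j m≤j r = reach-mono (subst (m ≤_) (+-identityʳ j) m≤j) r
  searchDist-reach {m = m} {u = u} {v} (suc f) j m≤j+f r with reach j u v in e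
  ... | true  = mkReach (subst T (sym e) _)
  ... | false = searchDist-reach f (suc j) (subst (m ≤_) (+-suc j f) m≤j+f) r

  dist-≤ : Reach k u v → dist u v ≤ k
  dist-≤ = searchDist-≤ n 0 z≤n

  walk-∷ʳ : WalkR R a b xs → R b c → WalkR R a c (xs ∷ʳ c)
  walk-∷ʳ (single _) r  = step r (single _)
  walk-∷ʳ (step r′ w) r = step r′ (walk-∷ʳ w r)

  walk-map : (∀ {x y} → R x y → S x y) → WalkR R a b xs → WalkR S a b xs
  walk-map f (single x) = single x
  walk-map f (step r w) = step (f r) (walk-map f w)

  walk-reverse : (∀ {x y} → R x y → R y x) → WalkR R a b xs → WalkR R b a (reverse xs)
  walk-reverse R-sym (single x) = single x
  walk-reverse R-sym (step {u = a} {xs = xs} r w) =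
    subst (WalkR _ _ a) (sym (unfold-reverse a xs)) (walk-∷ʳ (walk-reverse R-sym w) (R-sym r))

  walk-head-∈ : WalkR R a b xs → a ∈ xs
  walk-head-∈ (single _) = here refl
  walk-head-∈ (step _ _) = here refl

  walk-last-∈ : WalkR R a b xs → b ∈ xs
  walk-last-∈ (single _) = here refl
  walk-last-∈ (step _ w) = there (walk-last-∈ w)

  walk-++ : WalkR R a b xs → WalkR R b c ys →
    ∃ λ zs → WalkR R a c zs × b ∈ zs × length xs + length ys ≡ suc (length zs)
  walk-++ (single _) w = _ , w , walk-head-∈ w , refl
  walk-++ (step r w₁) w₂ with walk-++ w₁ w₂
  ... | zs , w , b∈zs , e = _ ∷ zs , step r w , there b∈zs , cong suc e

  walk-split : WalkR R a b xs → z ∈ xs →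
    ∃₂ λ ys zs → WalkR R a z ys × WalkR R z b zs × length ys + length zs ≡ suc (length xs)
  walk-split (single _) (here refl) = _ , _ , single _ , single _ , refl
  walk-split (step r w) (here refl) = _ , _ , single _ , step r w , refl
  walk-split (step r w) (there z∈) with walk-split w z∈
  ... | ys , zs , w₁ , w₂ , e = _ ∷ ys , zs , step r w₁ , w₂ , cong suc e

  walk-exit : {P : V → Set} → Decidable P → WalkR R a b xs → P a → ¬ P b →
    ∃₂ λ s t → R s t × P s × ¬ P t ×
      ∃₂ λ ys zs → WalkR R a s ys × WalkR R t b zs × length ys + length zs ≡ length xs
  walk-exit P? (single _) Pa ¬Pb = ⊥-elim (¬Pb Pa)
  walk-exit P? (step {w = w} r ws) Pa ¬Pb with P? w
  ... | no ¬Pw = _ , w , r , Pa , ¬Pw , _ , _ , single _ , ws , refl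
  ... | yes Pw with walk-exit P? ws Pw ¬Pb
  ...   | s , t , st , Ps , ¬Pt , ys , zs , w₁ , w₂ , e =
          s , t , st , Ps , ¬Pt , _ ∷ ys , zs , step r w₁ , w₂ , cong suc e

  walk-length-≥2 : WalkR R a b xs → a ≢ b → 2 ≤ length xs
  walk-length-≥2 (single _) a≢a = ⊥-elim (a≢a refl)
  walk-length-≥2 (step _ (single _)) _ = ≤-refl
  walk-length-≥2 (step _ (step _ _)) _ = s≤s (s≤s z≤n)

  walk-source≡head : WalkR R a b (y ∷ ys) → a ≡ y
  walk-source≡head (single _) = refl
  walk-source≡head (step _ _) = refl

  walk-source-split : ∀ pre {post} → WalkR R a b (pre ++ x ∷ post) → a ≡ x ⊎ a ∈ pre
  walk-source-split []      w = inj₁ (walk-source≡head w)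
  walk-source-split (_ ∷ _) w = inj₂ (here (walk-source≡head w))

  walk-target-split : ∀ pre {post} → WalkR R a b (pre ++ x ∷ post) → b ≡ x ⊎ b ∈ post
  walk-target-split []          {[]}    (single _) = inj₁ refl
  walk-target-split []          {_ ∷ _} (step _ w) = inj₂ (walk-last-∈ w)
  walk-target-split (_ ∷ [])    (step _ w) = walk-target-split [] w
  walk-target-split (_ ∷ y ∷ pre) (step _ w) = walk-target-split (y ∷ pre) w

  consec-∈ : Consec a b xs → a ∈ xs × b ∈ xs
  consec-∈ here      = here refl , there (here refl)
  consec-∈ (there c) = let a∈ , b∈ = consec-∈ c in there a∈ , there b∈

  AdjWithout-flip : AdjWithout a b x y → AdjWithout a b y x
  AdjWithout-flip (xy , ¬ab , ¬ba) =
    adj-sym xy , (λ (y≡a , x≡b) → ¬ba (x≡b , y≡a)) , λ (y≡b , x≡a) → ¬ab (x≡a , y≡b)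

  AdjWithout-swap : AdjWithout a b x y → AdjWithout b a x y
  AdjWithout-swap (xy , ¬ab , ¬ba) = xy , ¬ba , ¬ab

  walk-suffix : WalkR R a b xs → Distinct xs → z ∈ xs →
    ∃ λ ys → WalkR R z b ys × Distinct ys × length ys ≤ length xs
  walk-suffix (single _) d (here refl) = _ , single _ , d , ≤-refl
  walk-suffix (step r w) d (here refl) = _ , step r w , d , ≤-refl
  walk-suffix (step _ w) (_ ∷ d) (there z∈) with walk-suffix w d z∈
  ... | ys , w′ , d′ , le = ys , w′ , d′ , m≤n⇒m≤1+n le

  walk⇒path : WalkR R a b xs → ∃ λ ys → WalkR R a b ys × Distinct ys × length ys ≤ length xs
  walk⇒path (single x) = _ , single x , (λ ()) ∷ [] , ≤-refl
  walk⇒path {a = a} (step r w) with walk⇒path w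
  ... | ys , w′ , d , le with a ∈? ys
  ...   | yes a∈ = let zs , w″ , d′ , le′ = walk-suffix w′ d a∈ in
                   zs , w″ , d′ , m≤n⇒m≤1+n (≤-trans le′ le)
  ...   | no  a∉ = a ∷ ys , step r w′ , a∉ ∷ d , s≤s le

  ∈-─ : ∀ {xs} (x∈ : x ∈ xs) → y ∈ xs → y ≢ x → y ∈ (xs ─ x∈)
  ∈-─ (here refl) (here refl) y≢x = ⊥-elim (y≢x refl)
  ∈-─ (here _)    (there y∈)  _   = y∈
  ∈-─ (there _)   (here refl) _   = here refl
  ∈-─ (there x∈)  (there y∈)  y≢x = there (∈-─ x∈ y∈ y≢x)

  distinct-⊆-length : Distinct xs → xs ⊆ ys → length xs ≤ length ys
  distinct-⊆-length [] _ = z≤n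
  distinct-⊆-length {x ∷ xs} {ys} (x∉ ∷ d) xs⊆ys = begin
    suc (length xs)          ≤⟨ s≤s (distinct-⊆-length d xs⊆ys─x) ⟩
    suc (length (ys ─ x∈ys)) ≡⟨ length-removeAt′ ys (index x∈ys) ⟨
    length ys                ∎
    where
    open ≤-Reasoning
    x∈ys : x ∈ ys
    x∈ys = xs⊆ys (here refl)
    xs⊆ys─x : xs ⊆ (ys ─ x∈ys)
    xs⊆ys─x y∈ = ∈-─ x∈ys (xs⊆ys (there y∈)) λ { refl → x∉ y∈ }

  distinct-length-≤ : Distinct xs → length xs ≤ n
  distinct-length-≤ {xs} d = subst (length xs ≤_) (length-tabulate id) (distinct-⊆-length d λ {x} _ → ∈-allFin x)

  walk→reach : Walk a b xs → Reach (pred (length xs)) a b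
  walk→reach (single _)            = reach-refl 0 _
  walk→reach (step ab (single _))  = reach-cons ab (reach-refl 0 _)
  walk→reach (step ab w@(step _ _)) = reach-cons ab (walk→reach w)

  reach→walk : ∀ k → Reach k a b → ∃ λ xs → Walk a b xs × length xs ≤ suc k
  reach→walk zero r with reach-zero r
  ... | refl = _ , single _ , ≤-refl
  reach→walk (suc k) r with reach-unsnoc r
  ... | inj₁ r′ = let xs , w , le = reach→walk k r′ in xs , w , m≤n⇒m≤1+n le
  ... | inj₂ (_ , r′ , a) = let xs , w , le = reach→walk k r′ in
        xs ∷ʳ _ , walk-∷ʳ w a , ≤-trans (≤-reflexive (trans (length-++ xs) (+-comm (length xs) 1))) (s≤s le)

  walk-length-≥ : Walk a b xs → suc (dist a b) ≤ length xs
  walk-length-≥ w@(single _) = s≤s (dist-≤ (walk→reach w))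
  walk-length-≥ w@(step _ _) = s≤s (dist-≤ (walk→reach w))

  module Metric (conn : Connected) where

    reach-n : ∀ u v → Reach n u v
    reach-n u v with walk⇒path (proj₂ (conn u v))
    ... | _ , w , d , _ = reach-mono (≤-trans pred[n]≤n (distinct-length-≤ d)) (walk→reach w)

    dist-reach : ∀ u v → Reach (dist u v) u v
    dist-reach u v = searchDist-reach n 0 ≤-refl (reach-n u v)

    dist-refl : ∀ u → dist u u ≡ 0
    dist-refl u = n≤0⇒n≡0 (dist-≤ (reach-refl 0 u))

    dist≡0⇒≡ : dist u v ≡ 0 → u ≡ v
    dist≡0⇒≡ {u} {v} e = reach-zero (subst (λ m → Reach m u v) e (dist-reach u v))

    dist-sym : ∀ u v → dist u v ≡ dist v u
    dist-sym u v = ≤-antisym (dist-≤ (reach-sym _ (dist-reach v u))) (dist-≤ (reach-sym _ (dist-reach u v)))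

    dist-triangle : ∀ u v w → dist u w ≤ dist u v + dist v w
    dist-triangle u v w = dist-≤ (reach-trans _ _ (dist-reach u v) (dist-reach v w))

    dist-adj : Adj u v → dist u v ≤ 1
    dist-adj uv = dist-≤ (reach-cons uv (reach-refl 0 _))

    dist-stepˡ : Adj u v → dist u w ≤ suc (dist v w)
    dist-stepˡ {v = v} {w} uv = dist-≤ (reach-cons uv (dist-reach v w))

    dist-stepʳ : Adj v w → dist u w ≤ suc (dist u v)
    dist-stepʳ {v = v} {u = u} vw = dist-≤ (reach-snoc (dist-reach u v) vw)

    dist-split : ∀ k l → dist x y ≤ k + l → ∃ λ z → dist x z ≤ k × dist z y ≤ l
    dist-split {x} {y} k l le with reach-split k l (reach-mono le (dist-reach x y))
    ... | z , r₁ , r₂ = z , dist-≤ r₁ , dist-≤ r₂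

    shortestPath-exists : ∀ a b → ∃ (ShortestPath a b)
    shortestPath-exists a b with reach→walk _ (dist-reach a b)
    ... | xs , w , le = xs , w , ≤-antisym le (walk-length-≥ w)

    Between : V → V → V → Set
    Between a z b = dist a z + dist z b ≤ dist a b

    shortestPath⇒Between : ShortestPath a b xs → z ∈ xs → Between a z b
    shortestPath⇒Between {a} {b} {z = z} (w , len) z∈ with walk-split w z∈
    ... | ys , zs , w₁ , w₂ , e = ≤-pred (≤-pred (begin
      suc (suc (dist a z + dist z b))  ≡⟨ +-suc (suc (dist a z)) (dist z b) ⟨
      suc (dist a z) + suc (dist z b)  ≤⟨ +-mono-≤ (walk-length-≥ w₁) (walk-length-≥ w₂) ⟩
      length ys + length zs            ≡⟨ trans e (cong suc len) ⟩
      suc (suc (dist a b))             ∎))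
      where open ≤-Reasoning

    Between⇒shortestPath : Between a z b → ∃ λ xs → ShortestPath a b xs × z ∈ xs
    Between⇒shortestPath {a} {z} {b} le with shortestPath-exists a z | shortestPath-exists z b
    ... | xs , w₁ , l₁ | ys , w₂ , l₂ with walk-++ w₁ w₂
    ...   | zs , w , z∈ , e = zs , (w , ≤-antisym (≤-pred zs-length) (walk-length-≥ w)) , z∈
      where
      open ≤-Reasoning
      zs-length : suc (length zs) ≤ suc (suc (dist a b))
      zs-length = begin
        suc (length zs)                  ≡⟨ e ⟨
        length xs + length ys            ≡⟨ cong₂ _+_ l₁ l₂ ⟩
        suc (dist a z) + suc (dist z b)  ≡⟨ +-suc (suc (dist a z)) (dist z b) ⟩
        suc (suc (dist a z + dist z b))  ≤⟨ s≤s (s≤s le) ⟩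
        suc (suc (dist a b))             ∎

    shortestPath-exit : {P : V → Set} → Decidable P → P x → ¬ P y →
      ∃₂ λ s t → Adj s t × P s × ¬ P t × dist x s + dist t y + 1 ≤ dist x y
    shortestPath-exit {x} {y} P? Px ¬Py with shortestPath-exists x y
    ... | xs , w , len with walk-exit P? w Px ¬Py
    ...   | s , t , st , Ps , ¬Pt , ys , zs , w₁ , w₂ , e = s , t , st , Ps , ¬Pt , ≤-pred (begin
      suc (dist x s + dist t y + 1)    ≡⟨ cong suc (trans (+-assoc (dist x s) (dist t y) 1)
                                                          (cong (_+_ (dist x s)) (+-comm (dist t y) 1))) ⟩
      suc (dist x s) + suc (dist t y)  ≤⟨ +-mono-≤ (walk-length-≥ w₁) (walk-length-≥ w₂) ⟩
      length ys + length zs            ≡⟨ trans e len ⟩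
      suc (dist x y)                   ∎)
      where open ≤-Reasoning

    shortestPath-avoids : dist z t ≤ dist z u → ShortestPath z t xs → WalkR (AdjWithout t u) z t xs
    shortestPath-avoids _ (single _ , _) = single _
    shortestPath-avoids {z} {t} {u} zt≤zu (step {w = w} {xs = ys} zw ws , len) =
      step (zw , z≢t , z≢u) (shortestPath-avoids wt≤wu (ws , ws-length))
      where
      ys-length : length ys ≡ dist z t
      ys-length = suc-injective len
      wt<zt : suc (dist w t) ≤ dist z t
      wt<zt = subst (suc (dist w t) ≤_) ys-length (walk-length-≥ ws)
      ws-length : length ys ≡ suc (dist w t)
      ws-length = trans ys-length (≤-antisym (dist-stepˡ zw) wt<zt)
      wt≤wu : dist w t ≤ dist w u
      wt≤wu = ≤-pred (≤-trans wt<zt (≤-trans zt≤zu (dist-stepˡ zw)))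
      z≢t : ¬ (z ≡ t × w ≡ u)
      z≢t (refl , _) = contradiction (subst (suc (dist w z) ≤_) (dist-refl z) wt<zt) λ ()
      z≢u : ¬ (z ≡ u × w ≡ t)
      z≢u (refl , _) = contradiction (subst (suc (dist w t) ≤_) (dist-refl z) (≤-trans wt<zt zt≤zu)) λ ()

    geodesic-point : l ≤ dist t u → dist t u ≤ dist t v → ∃ λ y → dist y u ≡ l × l ≤ dist y v
    geodesic-point {l} {t} {u} {v} l≤tu tu≤tv
      with dist-split (dist t u ∸ l) l (≤-reflexive (sym (m∸n+n≡m l≤tu)))
    ... | y , ty≤ , yu≤l =
      y , ≤-antisym yu≤l (+-cancelˡ-≤ (dist t y) _ _ l≤yu) , +-cancelˡ-≤ (dist t y) _ _ l≤yv
      where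
      ty+l≤tu : dist t y + l ≤ dist t u
      ty+l≤tu = ≤-trans (+-monoˡ-≤ l ty≤) (≤-reflexive (m∸n+n≡m l≤tu))
      l≤yu : dist t y + l ≤ dist t y + dist y u
      l≤yu = ≤-trans ty+l≤tu (dist-triangle t y u)
      l≤yv : dist t y + l ≤ dist t y + dist y v
      l≤yv = ≤-trans ty+l≤tu (≤-trans tu≤tv (dist-triangle t y v))

    reverse-triangle-≤ : l + l ≤ dist t u → dist y u ≡ l → l ≤ dist t y
    reverse-triangle-≤ {l} {t} {u} {y} 2l≤tu yu≡l = +-cancelʳ-≤ l _ _ (begin
      l + l              ≤⟨ 2l≤tu ⟩
      dist t u           ≤⟨ dist-triangle t y u ⟩
      dist t y + dist y u ≡⟨ cong (_+_ (dist t y)) yu≡l ⟩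
      dist t y + l       ∎)
      where open ≤-Reasoning

    module Edge (p q : V) (pq : Adj p q) where
      open WithEdge p q

      private variable
        i j : ℤ
        D Dᵢ Dⱼ : ℕ

      dp dq : V → ℕ
      dp v = dist v p
      dq v = dist v q

      dq≤1+dp : ∀ v → dq v ≤ suc (dp v)
      dq≤1+dp v = dist-stepʳ pq

      dp≤1+dq : ∀ v → dp v ≤ suc (dq v)
      dp≤1+dq v = dist-stepʳ (adj-sym pq)

      dq≡1+dp⇒level≡one : dq v ≡ suc (dp v) → level v ≡ one
      dq≡1+dp⇒level≡one {v} e = trans (cong (λ m → + m - + dp v) e) (+[1+m]-+m≡1 (dp v))

      dq≡dp⇒level≡zero : dq v ≡ dp v → level v ≡ zero'
      dq≡dp⇒level≡zero {v} e = trans (cong (λ m → + m - + dp v) e) (+m-+m≡0 (dp v))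

      dp≡1+dq⇒level≡minusOne : dp v ≡ suc (dq v) → level v ≡ minusOne
      dp≡1+dq⇒level≡minusOne {v} e = trans (cong (λ m → + dq v - + m) e) (+m-+[1+m]≡-1 (dq v))

      data Layer (v : V) : ℤ → Set where
        layer₁  : dq v ≡ suc (dp v) → Layer v one
        layer₀  : dq v ≡ dp v       → Layer v zero'
        layer₋₁ : dp v ≡ suc (dq v) → Layer v minusOne

      layer : ∀ v → Layer v (level v)
      layer v with <-cmp (dp v) (dq v)
      ... | tri< dp<dq _ _ = let e = ≤-antisym (dq≤1+dp v) dp<dq in
                             subst (Layer v) (sym (dq≡1+dp⇒level≡one e)) (layer₁ e)
      ... | tri≈ _ dp≡dq _ = subst (Layer v) (sym (dq≡dp⇒level≡zero (sym dp≡dq))) (layer₀ (sym dp≡dq))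
      ... | tri> _ _ dq<dp = let e = ≤-antisym (dp≤1+dq v) dq<dp in
                             subst (Layer v) (sym (dp≡1+dq⇒level≡minusOne e)) (layer₋₁ e)

      level≡one⇒dq≡1+dp : level v ≡ one → dq v ≡ suc (dp v)
      level≡one⇒dq≡1+dp {v} e with subst (Layer v) e (layer v)
      ... | layer₁ e′ = e′

      level≡zero⇒dq≡dp : level v ≡ zero' → dq v ≡ dp v
      level≡zero⇒dq≡dp {v} e with subst (Layer v) e (layer v)
      ... | layer₀ e′ = e′

      level≡minusOne⇒dp≡1+dq : level v ≡ minusOne → dp v ≡ suc (dq v)
      level≡minusOne⇒dp≡1+dq {v} e with subst (Layer v) e (layer v)
      ... | layer₋₁ e′ = e′

      p≢q : p ≢ q
      p≢q refl = irrefl pq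

      dq-p : dq p ≡ 1
      dq-p = ≤-antisym (dist-adj pq) (n≢0⇒n>0 (p≢q ∘ dist≡0⇒≡))

      dp-q : dp q ≡ 1
      dp-q = ≤-antisym (dist-adj (adj-sym pq)) (n≢0⇒n>0 (p≢q ∘ sym ∘ dist≡0⇒≡))

      level-p : level p ≡ one
      level-p = dq≡1+dp⇒level≡one (trans dq-p (cong suc (sym (dist-refl p))))

      level-q : level q ≡ minusOne
      level-q = dp≡1+dq⇒level≡minusOne (trans dp-q (cong suc (sym (dist-refl q))))

      Run-⊆ : ∀ {C₀ its C′} → Run C₀ its C′ → ∀ {z} → C₀ z → C′ z
      Run-⊆ done = id
      Run-⊆ (step _ _ _ _ _ _ _ _ _ _ _ _ r) = Run-⊆ r ∘ inj₁

      Run-decidable : ∀ {C₀ its C′} → Run C₀ its C′ → Decidable C₀ → Decidable C′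
      Run-decidable done C₀? = C₀?
      Run-decidable (step _ _ post pre′ _ _ _ _ _ _ _ _ r) C₀? =
        Run-decidable r λ z → C₀? z ⊎-dec (z ∈? post) ⊎-dec (z ∈? pre′)

      Run-captures : ∀ {C₀ its C′ Pu Pv} → Run C₀ its C′ → (u , v , Pu , Pv) ∈ its →
        Walk p u Pu → Walk v q Pv → C′ u × C′ v
      Run-captures {C₀ = C₀} (step pre x post pre′ y post′ refl Cx _ refl Cy _ r) (here refl) wu wv =
        Run-⊆ r (from-x (walk-target-split pre wu)) , Run-⊆ r (from-y (walk-source-split pre′ wv))
        where
        from-x : z ≡ x ⊎ z ∈ post → C₀ z ⊎ z ∈ post ⊎ z ∈ pre′
        from-x (inj₁ refl) = inj₁ Cx
        from-x (inj₂ z∈)   = inj₂ (inj₁ z∈)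
        from-y : z ≡ y ⊎ z ∈ pre′ → C₀ z ⊎ z ∈ post ⊎ z ∈ pre′
        from-y (inj₁ refl) = inj₁ Cy
        from-y (inj₂ z∈)   = inj₂ (inj₂ z∈)
      Run-captures (step _ _ _ _ _ _ _ _ _ _ _ _ r) (there t∈) wu wv = Run-captures r t∈ wu wv

      Stage1Edge : V → V → Set
      Stage1Edge u v = Adj u v × level u ≡ one × (level v ≡ zero' ⊎ level v ≡ minusOne)

      stage1Edge? : ∀ u v → Dec (Stage1Edge u v)
      stage1Edge? u v =
        adj? u v ×-dec (level u ℤ.≟ one) ×-dec ((level v ℤ.≟ zero') ⊎-dec (level v ℤ.≟ minusOne))

      -- The Stage-1 paths through z are all shortest paths, so membership reduces to distances.
      captured1? : Decidable Captured1
      captured1? z = map′ to-paths from-paths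
        (any? λ u → any? λ v → stage1Edge? u v ×-dec
          ((dist p z + dist z u ≤? dist p u) ⊎-dec (dist v z + dist z q ≤? dist v q)))
        where
        to-paths : (∃₂ λ u v → Stage1Edge u v × (Between p z u ⊎ Between v z q)) → Captured1 z
        to-paths (u , v , (uv , lu , lv) , inj₁ z-between) with Between⇒shortestPath z-between | shortestPath-exists v q
        ... | Pu , spu , z∈ | Pv , spv = u , v , Pu , Pv , (uv , lu , lv , spu , spv) , ∈-++⁺ˡ z∈
        to-paths (u , v , (uv , lu , lv) , inj₂ z-between) with shortestPath-exists p u | Between⇒shortestPath z-between
        ... | Pu , spu | Pv , spv , z∈ = u , v , Pu , Pv , (uv , lu , lv , spu , spv) , ∈-++⁺ʳ Pu z∈
        from-paths : Captured1 z → ∃₂ λ u v → Stage1Edge u v × (Between p z u ⊎ Between v z q)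
        from-paths (u , v , Pu , Pv , (uv , lu , lv , spu , spv) , z∈) with ∈-++⁻ Pu z∈
        ... | inj₁ z∈Pu = u , v , (uv , lu , lv) , inj₁ (shortestPath⇒Between spu z∈Pu)
        ... | inj₂ z∈Pv = u , v , (uv , lu , lv) , inj₂ (shortestPath⇒Between spv z∈Pv)

      module Capture (its : List Item) (en : Enumerates its) (C : V → Set) (run : Run Captured1 its C) where

        Cap : V → Set
        Cap = Final C

        captured? : Decidable Cap
        captured? z = Run-decidable run captured1? z ⊎-dec (z ≟ p) ⊎-dec (z ≟ q)

        on-stage1-path : ∀ {Pu Pv} → Stage1 u v Pu Pv → z ∈ Pu ++ Pv → Cap z
        on-stage1-path {u} {v} {Pu = Pu} {Pv} s₁ z∈ = inj₁ (Run-⊆ run (u , v , Pu , Pv , s₁ , z∈))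

        stage1-captured : Stage1Edge u v → Cap u × Cap v
        stage1-captured {u} {v} (uv , lu , lv) with shortestPath-exists p u | shortestPath-exists v q
        ... | Pu , spu | Pv , spv =
          on-stage1-path s₁ (∈-++⁺ˡ (walk-last-∈ (proj₁ spu))) ,
          on-stage1-path s₁ (∈-++⁺ʳ Pu (walk-head-∈ (proj₁ spv)))
          where
          s₁ : Stage1 u v Pu Pv
          s₁ = uv , lu , lv , spu , spv

        oriented-captured : OrientedInStage1 u v → Cap u × Cap v
        oriented-captured (_ , _ , _ , _ , s₁ , inj₁ c) =
          let u∈ , v∈ = consec-∈ c in on-stage1-path s₁ u∈ , on-stage1-path s₁ v∈
        oriented-captured (_ , _ , _ , _ , s₁ , inj₂ c) =
          let v∈ , u∈ = consec-∈ c in on-stage1-path s₁ u∈ , on-stage1-path s₁ v∈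

        -- An edge left unoriented by Stage 1 is a Stage-2 item, which the run captures.
        stage2-captured : Adj u v → level u ≡ zero' → level v ≡ minusOne → Cap u × Cap v
        stage2-captured {u} {v} uv lu lv with captured? u ×-dec captured? v
        ... | yes caps = caps
        ... | no ¬caps with shortestPath-exists p u | shortestPath-exists v q
        ...   | Pu , spu | Pv , spv =
          let item∈ = proj₂ en (u , v , Pu , Pv) (uv , lu , lv , ¬caps ∘ oriented-captured , spu , spv)
              Cu , Cv = Run-captures run item∈ (proj₁ spu) (proj₁ spv)
          in inj₁ Cu , inj₁ Cv

        cross-level-captured : Adj s t → level s ≢ level t → Cap s
        cross-level-captured {s} {t} st ls≢lt with level s | layer s | level t | layer t
        ... | _ | layer₁ _   | _ | layer₁ _   = ⊥-elim (ls≢lt refl)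
        ... | _ | layer₁ e   | _ | layer₀ e′  =
          proj₁ (stage1-captured (st , dq≡1+dp⇒level≡one e , inj₁ (dq≡dp⇒level≡zero e′)))
        ... | _ | layer₁ e   | _ | layer₋₁ e′ =
          proj₁ (stage1-captured (st , dq≡1+dp⇒level≡one e , inj₂ (dp≡1+dq⇒level≡minusOne e′)))
        ... | _ | layer₀ e   | _ | layer₁ e′  =
          proj₂ (stage1-captured (adj-sym st , dq≡1+dp⇒level≡one e′ , inj₁ (dq≡dp⇒level≡zero e)))
        ... | _ | layer₀ _   | _ | layer₀ _   = ⊥-elim (ls≢lt refl)
        ... | _ | layer₀ e   | _ | layer₋₁ e′ =
          proj₁ (stage2-captured st (dq≡dp⇒level≡zero e) (dp≡1+dq⇒level≡minusOne e′))
        ... | _ | layer₋₁ e  | _ | layer₁ e′  =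
          proj₂ (stage1-captured (adj-sym st , dq≡1+dp⇒level≡one e′ , inj₂ (dp≡1+dq⇒level≡minusOne e)))
        ... | _ | layer₋₁ e  | _ | layer₀ e′  =
          proj₂ (stage2-captured (adj-sym st) (dq≡dp⇒level≡zero e′) (dp≡1+dq⇒level≡minusOne e))
        ... | _ | layer₋₁ _  | _ | layer₋₁ _  = ⊥-elim (ls≢lt refl)

        Apart : ℤ → ℕ → V → Set
        Apart i D x = ∀ w → Cap w → level w ≡ i → D ≤ dist x w

        escape : level x ≡ i → Apart i D x → level y ≢ i →
          ∃₂ λ s t → Adj s t × level s ≡ i × level t ≢ i × D + dist t y + 1 ≤ dist x y
        escape {x} {i} {D} {y} lx apart ly with shortestPath-exit (λ v → level v ℤ.≟ i) lx ly
        ... | s , t , st , ls , lt , le =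
          s , t , st , ls , lt , ≤-trans (+-monoˡ-≤ 1 (+-monoˡ-≤ (dist t y) D≤xs)) le
          where
          D≤xs : D ≤ dist x s
          D≤xs = apart s (cross-level-captured st λ e → lt (trans (sym e) ls)) ls

        apart-≤-captured : level x ≡ i → Apart i D x → Cap t → D ≤ dist x t
        apart-≤-captured {i = i} {D} {t} lx apart Ct with level t ℤ.≟ i
        ... | yes lt = apart t Ct lt
        ... | no  lt = let _ , _ , _ , _ , _ , le = escape lx apart lt in
                       ≤-trans (m≤m+n D _) (≤-trans (m≤m+n _ 1) le)

      module Cycle (k : ℕ) (scl : ShortestCycleLength p q k) where

        cycle-length-≥ : WalkR (AdjWithout p q) q p xs → k ≤ length xs
        cycle-length-≥ w with walk⇒path w
        ... | ys , w′ , d , le = ≤-trans (proj₂ scl (length ys) (ys , w′ , d , refl)) le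

        cycle-through : WalkR (AdjWithout p q) q z xs → WalkR (AdjWithout p q) z p ys →
          suc k ≤ length xs + length ys
        cycle-through w₁ w₂ with walk-++ w₁ w₂
        ... | zs , w , _ , e = subst (suc k ≤_) (sym e) (s≤s (cycle-length-≥ w))

        from-q : dq z ≤ dp z → ∃ λ xs → WalkR (AdjWithout p q) q z xs × length xs ≡ suc (dq z)
        from-q {z} le with shortestPath-exists z q
        ... | xs , sp = reverse xs ,
          walk-reverse AdjWithout-flip (walk-map AdjWithout-swap (shortestPath-avoids le sp)) ,
          trans (length-reverse xs) (proj₂ sp)

        to-p : dp z ≤ dq z → ∃ λ ys → WalkR (AdjWithout p q) z p ys × length ys ≡ suc (dp z)
        to-p {z} le with shortestPath-exists z p
        ... | ys , sp = ys , shortestPath-avoids le sp , proj₂ sp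

        tie-cycle-≤ : dq z ≡ dp z → k ≤ suc (dq z + dp z)
        tie-cycle-≤ {z} e with from-q (≤-reflexive e) | to-p (≤-reflexive (sym e))
        ... | xs , w₁ , l₁ | ys , w₂ , l₂ = ≤-pred (begin
          suc k                      ≤⟨ cycle-through w₁ w₂ ⟩
          length xs + length ys      ≡⟨ cong₂ _+_ l₁ l₂ ⟩
          suc (dq z) + suc (dp z)    ≡⟨ cong suc (+-suc (dq z) (dp z)) ⟩
          suc (suc (dq z + dp z))    ∎)
          where open ≤-Reasoning

        tie-half-≤ : dq z ≡ dp z → k / 2 ≤ dp z
        tie-half-≤ {z} e = half-≤ (subst (λ m → k ≤ suc (m + dp z)) e (tie-cycle-≤ e))

        -- The cycle runs q ⇝ v → u ⇝ p along shortest paths.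
        cross-cycle-≤ : Adj u v → dq u ≡ suc (dp u) → dp v ≡ suc (dq v) → ¬ (u ≡ p × v ≡ q) →
          k ≤ 2 + (dq v + dp u)
        cross-cycle-≤ {u} {v} uv eu ev uv≢pq
          with from-q (subst (dq v ≤_) (sym ev) (n≤1+n (dq v))) | to-p (subst (dp u ≤_) (sym eu) (n≤1+n (dp u)))
        ... | xs , w₁ , l₁ | ys , w₂ , l₂ = ≤-pred (begin
          suc k                            ≤⟨ cycle-through w₁ (step vu w₂) ⟩
          length xs + suc (length ys)      ≡⟨ cong₂ (λ a b → a + suc b) l₁ l₂ ⟩
          suc (dq v) + suc (suc (dp u))    ≡⟨ rearrange (dq v) (dp u) ⟩
          suc (2 + (dq v + dp u))          ∎)
          where
          open ≤-Reasoning
          rearrange : ∀ a b → suc a + suc (suc b) ≡ suc (2 + (a + b))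
          rearrange = solve-∀
          vu : AdjWithout p q v u
          vu = adj-sym uv ,
               (λ { (refl , _) → 0≢1+n (trans (sym (dist-refl p)) ev) }) ,
               λ (v≡q , u≡p) → uv≢pq (u≡p , v≡q)

        cross-edge-balanced : Adj u v → dq u ≡ suc (dp u) → dp v ≡ suc (dq v) → dq v ≡ dp u
        cross-edge-balanced {u} {v} uv eu ev = ≤-antisym
          (≤-pred (subst (_≤ suc (dp u)) ev (dist-stepˡ (adj-sym uv))))
          (≤-pred (subst (_≤ suc (dq v)) eu (dist-stepˡ uv)))

        2≤k : 2 ≤ k
        2≤k = let _ , w , _ , len = proj₁ scl in subst (2 ≤_) len (walk-length-≥2 w (p≢q ∘ sym))

        cycle-exit : {P : V → Set} → Decidable P → P q → ¬ P p →
          ∃₂ λ s t → AdjWithout p q s t × P s × ¬ P t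
        cycle-exit P? Pq ¬Pp =
          let _ , w , _ = proj₁ scl
              s , t , st , Ps , ¬Pt , _ = walk-exit P? w Pq ¬Pp
          in s , t , st , Ps , ¬Pt

        exit₁ : ∃₂ λ s t → Adj s t × level s ≡ one × level t ≢ one × ¬ (s ≡ p × t ≡ q)
        exit₁ with cycle-exit (λ v → ¬? (level v ℤ.≟ one))
                     (λ e → contradiction (trans (sym level-q) e) λ ()) (λ ¬e → ¬e level-p)
        ... | t , s , (ts , _ , ts≢qp) , lt , ¬¬ls =
          s , t , adj-sym ts , decidable-stable (level s ℤ.≟ one) ¬¬ls , lt ,
          λ (s≡p , t≡q) → ts≢qp (t≡q , s≡p)

        exit₋₁ : ∃₂ λ s t → Adj s t × level s ≡ minusOne × level t ≢ minusOne × ¬ (s ≡ q × t ≡ p)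
        exit₋₁ with cycle-exit (λ v → level v ℤ.≟ minusOne) level-q
                      (λ e → contradiction (trans (sym level-p) e) λ ())
        ... | s , t , (st , _ , st≢qp) , ls , lt = s , t , st , ls , lt , st≢qp

        exit₁-bound : Adj s t → level s ≡ one → level t ≢ one → ¬ (s ≡ p × t ≡ q) →
          k ≤ 2 + (dq t + dq t) × dq t ≤ dp t
        exit₁-bound {s} {t} st ls lt st≢pq with level t | layer t
        ... | _ | layer₁ _  = ⊥-elim (lt refl)
        ... | _ | layer₀ e  =
          m≤n⇒m≤1+n (subst (λ m → k ≤ suc (dq t + m)) (sym e) (tie-cycle-≤ e)) , ≤-reflexive e
        ... | _ | layer₋₁ e =
          subst (λ m → k ≤ 2 + (dq t + m)) (sym (cross-edge-balanced st eu e)) (cross-cycle-≤ st eu e st≢pq) ,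
          subst (dq t ≤_) (sym e) (n≤1+n (dq t))
          where
          eu : dq s ≡ suc (dp s)
          eu = level≡one⇒dq≡1+dp ls

        exit₋₁-bound : Adj s t → level s ≡ minusOne → level t ≢ minusOne → ¬ (s ≡ q × t ≡ p) →
          k ≤ 2 + (dp t + dp t) × dp t ≤ dq t
        exit₋₁-bound {s} {t} st ls lt st≢qp with level t | layer t
        ... | _ | layer₋₁ _ = ⊥-elim (lt refl)
        ... | _ | layer₀ e  =
          m≤n⇒m≤1+n (subst (λ m → k ≤ suc (m + dp t)) e (tie-cycle-≤ e)) , ≤-reflexive (sym e)
        ... | _ | layer₁ e  =
          subst (λ m → k ≤ 2 + (m + dp t)) (cross-edge-balanced (adj-sym st) e ev)
            (cross-cycle-≤ (adj-sym st) e ev λ (t≡p , s≡q) → st≢qp (s≡q , t≡p)) ,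
          subst (dp t ≤_) (sym e) (n≤1+n (dp t))
          where
          ev : dp s ≡ suc (dq s)
          ev = level≡minusOne⇒dp≡1+dq ls

        half≤dist : ∃ λ w → k / 2 ≤ dp w
        half≤dist with exit₋₁
        ... | s , t , st , ls , lt , st≢qp with exit₋₁-bound st ls lt st≢qp | level t | layer t
        ...   | _      | _ | layer₋₁ e = ⊥-elim (lt (dp≡1+dq⇒level≡minusOne e))
        ...   | _      | _ | layer₀ e  = t , tie-half-≤ e
        ...   | k≤ , _ | _ | layer₁ e  = s , half-≤ (subst (λ m → k ≤ suc (m + m)) (sym dp-s)
                (≤-trans k≤ (s≤s (s≤s (+-monoʳ-≤ (dp t) (n≤1+n (dp t)))))))
          where
          dp-s : dp s ≡ suc (dp t)
          dp-s = let ev = level≡minusOne⇒dp≡1+dq ls in trans ev (cong suc (cross-edge-balanced (adj-sym st) e ev))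

      module Bounds (its : List Item) (en : Enumerates its) (C : V → Set) (run : Run Captured1 its C)
                    (k : ℕ) (scl : ShortestCycleLength p q k) (d : ℕ) (diam : ∀ u v → dist u v ≤ d) where
        open Capture its en C run
        open Cycle k scl

        private
          s₀ : ℕ
          s₀ = (k + 3) / 4 ∸ 1

        NearCaptured : ℤ → ℕ → V → Set
        NearCaptured i D u = ∃ λ w → Cap w × level w ≡ i × dist u w ≤ D

        covered-at? : ∀ i D u → Dec (level u ≡ i → ¬ Cap u → NearCaptured i D u)
        covered-at? i D u = (level u ℤ.≟ i) →-dec ¬? (captured? u) →-dec
          any? λ w → captured? w ×-dec (level w ℤ.≟ i) ×-dec (dist u w ≤? D)

        uncovered-apart : ¬ (level u ≡ i → ¬ Cap u → NearCaptured i D u) →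
          level u ≡ i × ¬ Cap u × Apart i (suc D) u
        uncovered-apart {u} {i} ¬cov with level u ℤ.≟ i | captured? u
        ... | no  lu≢i | _      = ⊥-elim (¬cov λ lu → ⊥-elim (lu≢i lu))
        ... | yes _    | yes Cu = ⊥-elim (¬cov λ _ ¬Cu → ⊥-elim (¬Cu Cu))
        ... | yes lu   | no ¬Cu = lu , ¬Cu , λ w Cw lw → ≰⇒> λ le → ¬cov λ _ _ → w , Cw , lw , le

        -- Take the least D that covers every uncaptured level-i vertex; a vertex left uncovered
        -- at D − 1 realises the maximum.
        IsDi-exists : ∀ i → (∀ u → level u ≡ i → ¬ Cap u → ∃ λ w → Cap w × level w ≡ i) →
          ∃ (IsDi Cap i)
        IsDi-exists i has-captured
          with search-down (λ D → all? (covered-at? i D)) d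
                 (λ u lu ¬Cu → let w , Cw , lw = has-captured u lu ¬Cu in w , Cw , lw , diam u w)
        ... | D , cov , inj₁ D≡0 = D , cov , inj₁ D≡0
        ... | D , cov , inj₂ (D′ , refl , ¬cov) =
          let u , ¬cov-u = ¬∀⟶∃¬ n _ (covered-at? i D′) ¬cov in D , cov , inj₂ (u , uncovered-apart ¬cov-u)

        d₀-exists : ∃ (IsDi Cap zero')
        d₀-exists = IsDi-exists zero' λ u lu _ →
          let s , t , st , ls , lt , _ = shortestPath-exit {y = p} (λ v → level v ℤ.≟ zero') lu
                                           λ e → contradiction (trans (sym level-p) e) λ ()
          in s , cross-level-captured st (λ e → lt (trans (sym e) ls)) , ls

        d₁-exists : ∃ (IsDi Cap one)
        d₁-exists = IsDi-exists one λ _ _ _ → p , inj₂ (inj₁ refl) , level-p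

        d₋₁-exists : ∃ (IsDi Cap minusOne)
        d₋₁-exists = IsDi-exists minusOne λ _ _ _ → q , inj₂ (inj₂ refl) , level-q

        half≤d : k / 2 ≤ d
        half≤d = let w , half≤ = half≤dist in ≤-trans half≤ (diam w p)

        off-level-endpoint : ∀ i → ∃ λ y → level y ≢ i
        off-level-endpoint i with i ℤ.≟ one
        ... | yes refl = q , λ e → contradiction (trans (sym level-q) e) λ ()
        ... | no  i≢1  = p , λ e → i≢1 (trans (sym e) level-p)

        isolation-bound : IsDi Cap i D → D + 1 ≤ d
        isolation-bound (_ , inj₁ refl) = subst (_≤ d) dq-p (diam p q)
        isolation-bound {i} {D} (_ , inj₂ (x , lx , _ , apart)) =
          let y , ly = off-level-endpoint i
              _ , _ , _ , _ , _ , le = escape lx apart ly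
          in ≤-trans (+-monoˡ-≤ 1 (m≤m+n D _)) (≤-trans le (diam x y))

        pair-bound : IsDi Cap i Dᵢ → IsDi Cap j Dⱼ → i ≢ j → Dᵢ + Dⱼ + 1 ≤ d
        pair-bound (_ , inj₁ refl) isDⱼ _ = isolation-bound isDⱼ
        pair-bound {Dᵢ = Dᵢ} isDᵢ (_ , inj₁ refl) _ =
          subst (λ m → m + 1 ≤ d) (sym (+-identityʳ Dᵢ)) (isolation-bound isDᵢ)
        pair-bound {Dᵢ = Dᵢ} {Dⱼ = Dⱼ} (_ , inj₂ (x , lx , _ , apartx)) (_ , inj₂ (y , ly , _ , aparty)) i≢j
          with escape lx apartx (λ e → i≢j (trans (sym e) ly))
        ... | s , t , st , ls , lt , le = begin
          Dᵢ + Dⱼ + 1        ≤⟨ +-monoˡ-≤ 1 (+-monoʳ-≤ Dᵢ Dⱼ≤ty) ⟩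
          Dᵢ + dist t y + 1  ≤⟨ le ⟩
          dist x y           ≤⟨ diam x y ⟩
          d                  ∎
          where
          open ≤-Reasoning
          Dⱼ≤ty : Dⱼ ≤ dist t y
          Dⱼ≤ty = subst (Dⱼ ≤_) (dist-sym y t)
            (apart-≤-captured ly aparty (cross-level-captured (adj-sym st) λ e → lt (trans e ls)))

        d₀-bound : IsDi Cap zero' D → D + k / 2 ≤ d
        d₀-bound (_ , inj₁ refl) = half≤d
        d₀-bound {D} (_ , inj₂ (x , lx , _ , apart))
          with escape lx apart (λ e → contradiction (trans (sym level-p) e) λ ())
        ... | s , t , st , ls , _ , le = begin
          D + k / 2       ≤⟨ +-monoʳ-≤ D (tie-half-≤ (level≡zero⇒dq≡dp ls)) ⟩
          D + dp s        ≤⟨ +-monoʳ-≤ D (dist-stepˡ st) ⟩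
          D + suc (dp t)  ≡⟨ trans (+-suc D (dp t)) (+-comm 1 (D + dp t)) ⟩
          D + dp t + 1    ≤⟨ le ⟩
          dist x p        ≤⟨ diam x p ⟩
          d               ∎
          where open ≤-Reasoning

        quarter-bound : s₀ ≤ l → D + l + 1 ≤ d → D + (k + 3) / 4 ≤ d
        quarter-bound {l} {D} s₀≤l le = begin
          D + (k + 3) / 4  ≤⟨ +-monoʳ-≤ D (m≤n+m∸n ((k + 3) / 4) 1) ⟩
          D + suc s₀       ≤⟨ +-monoʳ-≤ D (s≤s s₀≤l) ⟩
          D + suc l        ≡⟨ trans (+-suc D l) (+-comm 1 (D + l)) ⟩
          D + l + 1        ≤⟨ le ⟩
          d                ∎
          where open ≤-Reasoning

        -- Found on a shortest path to q from where the cycle leaves level 1.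
        far-vertex₁ : ∃ λ y → level y ≢ one × dq y ≡ s₀
        far-vertex₁ =
          let s , t , st , ls , lt , st≢pq = exit₁
              k≤ , dqt≤dpt = exit₁-bound st ls lt st≢pq
              y , dqy≡s₀ , s₀≤dpy = geodesic-point (≤-trans (m≤m+n s₀ s₀) (quarter∸1-double-≤ k≤)) dqt≤dpt
          in y , (λ ly → 1+n≰n (subst (suc s₀ ≤_) (trans (sym (level≡one⇒dq≡1+dp ly)) dqy≡s₀) (s≤s s₀≤dpy))) ,
             dqy≡s₀

        far-vertex₋₁ : ∃ λ y → level y ≢ minusOne × dp y ≡ s₀
        far-vertex₋₁ =
          let s , t , st , ls , lt , st≢qp = exit₋₁
              k≤ , dpt≤dqt = exit₋₁-bound st ls lt st≢qp
              y , dpy≡s₀ , s₀≤dqy = geodesic-point (≤-trans (m≤m+n s₀ s₀) (quarter∸1-double-≤ k≤)) dpt≤dqt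
          in y , (λ ly → 1+n≰n (subst (suc s₀ ≤_) (trans (sym (level≡minusOne⇒dp≡1+dq ly)) dpy≡s₀)
                                  (s≤s s₀≤dqy))) ,
             dpy≡s₀

        far-vertex₁-bound : level x ≡ one → Apart one D x → level y ≢ one → dq y ≡ s₀ →
          D + (k + 3) / 4 ≤ d
        far-vertex₁-bound {x} {D} {y} lx apart ly dqy≡s₀ with escape lx apart ly
        ... | s , t , st , ls , lt , le = quarter-bound s₀≤ty (≤-trans le (diam x y))
          where
          s₀≤ty : s₀ ≤ dist t y
          s₀≤ty with (s ≟ p) ×-dec (t ≟ q)
          ... | yes (refl , refl) = ≤-reflexive (trans (sym dqy≡s₀) (dist-sym y q))
          ... | no st≢pq =
            reverse-triangle-≤ (quarter∸1-double-≤ (proj₁ (exit₁-bound st ls lt st≢pq))) dqy≡s₀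

        far-vertex₋₁-bound : level x ≡ minusOne → Apart minusOne D x → level y ≢ minusOne → dp y ≡ s₀ →
          D + (k + 3) / 4 ≤ d
        far-vertex₋₁-bound {x} {D} {y} lx apart ly dpy≡s₀ with escape lx apart ly
        ... | s , t , st , ls , lt , le = quarter-bound s₀≤ty (≤-trans le (diam x y))
          where
          s₀≤ty : s₀ ≤ dist t y
          s₀≤ty with (s ≟ q) ×-dec (t ≟ p)
          ... | yes (refl , refl) = ≤-reflexive (trans (sym dpy≡s₀) (dist-sym y p))
          ... | no st≢qp =
            reverse-triangle-≤ (quarter∸1-double-≤ (proj₁ (exit₋₁-bound st ls lt st≢qp))) dpy≡s₀

        d₁-bound : IsDi Cap one D → D + (k + 3) / 4 ≤ d
        d₁-bound (_ , inj₁ refl) = ≤-trans (quarter≤half 2≤k) half≤d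
        d₁-bound (_ , inj₂ (_ , lx , _ , apart)) =
          let _ , ly , dqy≡s₀ = far-vertex₁ in far-vertex₁-bound lx apart ly dqy≡s₀

        d₋₁-bound : IsDi Cap minusOne D → D + (k + 3) / 4 ≤ d
        d₋₁-bound (_ , inj₁ refl) = ≤-trans (quarter≤half 2≤k) half≤d
        d₋₁-bound (_ , inj₂ (_ , lx , _ , apart)) =
          let _ , ly , dpy≡s₀ = far-vertex₋₁ in far-vertex₋₁-bound lx apart ly dpy≡s₀

lemma2 : ∀ {n} (G : Graph n) (d k : ℕ) (p q : GraphDefs.V G) →
    GraphDefs.TwoEdgeConnected G →
    GraphDefs.IsDiameter G d →
    Graph.Adj G p q →
    GraphDefs.ShortestCycleLength G p q k →
    (its : List (GraphDefs.WithEdge.Item G p q)) →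
    GraphDefs.WithEdge.Enumerates G p q its →
    (C : GraphDefs.V G → Set) →
    GraphDefs.WithEdge.Run G p q (GraphDefs.WithEdge.Captured1 G p q) its C →
    ∃ λ d₀ → ∃ λ d₁ → ∃ λ d₋₁ →
      GraphDefs.WithEdge.IsDi G p q (GraphDefs.WithEdge.Final G p q C) (GraphDefs.WithEdge.zero' G p q) d₀ ×
      GraphDefs.WithEdge.IsDi G p q (GraphDefs.WithEdge.Final G p q C) (GraphDefs.WithEdge.one G p q) d₁ ×
      GraphDefs.WithEdge.IsDi G p q (GraphDefs.WithEdge.Final G p q C) (GraphDefs.WithEdge.minusOne G p q) d₋₁ ×
      d₀ + k / 2 ≤ d ×
      d₁ + (k + 3) / 4 ≤ d ×
      d₋₁ + (k + 3) / 4 ≤ d ×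
      d₀ + d₁ + 1 ≤ d ×
      d₀ + d₋₁ + 1 ≤ d ×
      d₁ + d₋₁ + 1 ≤ d
lemma2 G d k p q (conn , _) (diam , _) pq scl its en C run =
  let d₀ , D₀ = d₀-exists
      d₁ , D₁ = d₁-exists
      d₋₁ , D₋₁ = d₋₁-exists
  in d₀ , d₁ , d₋₁ , D₀ , D₁ , D₋₁ ,
     d₀-bound D₀ , d₁-bound D₁ , d₋₁-bound D₋₁ ,
     pair-bound D₀ D₁ (λ ()) , pair-bound D₀ D₋₁ (λ ()) , pair-bound D₁ D₋₁ (λ ())
  where open Metric.Edge.Bounds G conn p q pq its en C run k scl d diam
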